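{- Let $\ell,m$ be integers with $1\le\ell<m$, and let $\mathbf{t}_{\ell,m}$ be the fixed point starting with $0$ of the morphism $0\mapsto0\ell m$, $\ell\mapsto\ell m0$, $m\mapsto m0\ell$ over the alphabet $\{0,\ell,m\}$. Then its abelian complexity is $\rho^{\mathrm{ab}}_{\mathbf{t}_{\ell,m}}=136(766)^\omega$, i.e., it takes values $1,3$ at $n=0,1$ and then, for $n\ge2$, equals $7$ if $n\equiv0\pmod3$ and $6$ otherwise. Its additive complexity satisfies $\rho^{\mathrm{add}}_{\mathbf{t}_{\ell,m}}=\rho^{\mathrm{ab}}_{\mathbf{t}_{\ell,m}}$ if $m\ne2\ell$, and $\rho^{\mathrm{add}}_{\mathbf{t}_{\ell,m}}=135^\omega$ (values $1,3$ at $n=0,1$ and $5$ for all $n\ge2$) if $m=2\ell$.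
   Context: Letters $0,\ell,m$ are regarded as integers. For a word $w$, $|w|_a$ counts occurrences of $a$. Words $u,v$ are abelian equivalent if $|u|_a=|v|_a$ for all letters $a$, and additively equivalent if $|u|=|v|$ and $\ell|u|_\ell+m|u|_m=\ell|v|_\ell+m|v|_m$. $\rho^{\mathrm{ab}}_{\mathbf{x}}(n)$ (resp. $\rho^{\mathrm{add}}_{\mathbf{x}}(n)$) is the number of abelian (resp. additive) equivalence classes of length-$n$ factors of $\mathbf{x}$. -}

module Defs where

open import Data.Nat using (ℕ; zero; suc; _+_; _*_; _%_; _≡ᵇ_)
open import Data.Fin using (Fin)
open import Data.Bool using (Bool; true; false; if_then_else_)
open import Data.List using (List; []; _∷_; concatMap; lookup; length)
open import Data.Product using (Σ; ∃; _×_)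
open import Relation.Binary.PropositionalEquality using (_≡_; _≢_)

-- The three-letter alphabet {0, ℓ, m}; the letter "ℓ" is L and "m" is M.
data Letter : Set where
  O L M : Letter

val : ℕ → ℕ → Letter → ℕ
val ℓ m O = 0
val ℓ m L = ℓ
val ℓ m M = m

σ : Letter → List Letter
σ O = O ∷ L ∷ M ∷ []
σ L = L ∷ M ∷ O ∷ []
σ M = M ∷ O ∷ L ∷ []

σ* : List Letter → List Letter
σ* = concatMap σ

σ^ : ℕ → List Letter → List Letter
σ^ zero w = w
σ^ (suc k) w = σ* (σ^ k w)

-- n-th letter of a list, with a default (never used below: |σ^(n+1)(0)| = 3^(n+1) > n)
nth : List Letter → ℕ → Letter
nth [] _ = O
nth (x ∷ xs) zero = x
nth (x ∷ xs) (suc n) = nth xs n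

-- the fixed point t_{ℓ,m} of σ starting with 0: its n-th letter is the n-th letter of σ^(n+1)(0)
t : ℕ → Letter
t n = nth (σ^ (suc n) (O ∷ [])) n

factor : ℕ → ℕ → List Letter
factor i zero = []
factor i (suc n) = t i ∷ factor (suc i) n

_≟L_ : Letter → Letter → ℕ
O ≟L O = 1
L ≟L L = 1
M ≟L M = 1
_ ≟L _ = 0

count : Letter → List Letter → ℕ
count a [] = 0
count a (x ∷ xs) = (a ≟L x) + count a xs

AbEq : List Letter → List Letter → Set
AbEq u v = (a : Letter) → count a u ≡ count a v

AddEq : ℕ → ℕ → List Letter → List Letter → Set
AddEq ℓ m u v = (length u ≡ length v)
  × (ℓ * count L u + m * count M u ≡ ℓ * count L v + m * count M v)

-- NumClasses R n k : the length-n factors of t fall into exactly k classes of R,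
-- i.e. there are k factors (at positions pos j) pairwise non-equivalent
-- such that every length-n factor is equivalent to one of them.
NumClasses : (List Letter → List Letter → Set) → ℕ → ℕ → Set
NumClasses R n k = Σ (Fin k → ℕ) λ pos →
    ((i j : Fin k) → R (factor (pos i) n) (factor (pos j) n) → i ≡ j)
  × ((p : ℕ) → ∃ λ (j : Fin k) → R (factor p n) (factor (pos j) n))

abValue : ℕ → ℕ
abValue zero = 1
abValue (suc zero) = 3
abValue (suc (suc n)) = if (suc (suc n)) % 3 ≡ᵇ 0 then 7 else 6

addValue2 : ℕ → ℕ
addValue2 zero = 1
addValue2 (suc zero) = 3
addValue2 (suc (suc n)) = 5

-- Since t (3i + k) = rot^k (t i), the word t is a concatenation of blocks σ(x), each containing
-- every letter once. A factor of length r + 3(N+1) starting at s + 3i therefore contains every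
-- letter N + e times, where the excess e only depends on r, s and the two letters whose images
-- contain the ends of the factor.
-- Every pair of letters occurs at every positive distance, so all these situations occur, and the
-- classes of long factors are counted by evaluating the finitely many excess vectors: 7, 6, 6
-- distinct ones for r = 0, 1, 2, and 5 distinct weights |w|_ℓ + 2|w|_m. For m ≠ 2ℓ all counts of
-- a given letter in factors of a given length lie within 2 of each other, and ℓ j = m k has no
-- solution with 0 < j, k ≤ 2, so additive and abelian equivalence agree on factors of t.
-- Lengths n ≤ 2 are handled by listing all words, every word of length at most 2 being a factor.

{-# OPTIONS --safe #-}
module Submission where

open import Defs
open import Data.Bool using (if_then_else_)
open import Data.Empty using (⊥-elim)
open import Data.Fin using (Fin; toℕ; zero; suc)
open import Data.Fin.Properties using (toℕ<n; toℕ≤pred[n])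
open import Data.List
  using (List; []; _∷_; _++_; length; take; map; lookup; deduplicate; allFin; cartesianProduct; cartesianProductWith)
open import Data.List.Properties using (concatMap-++; ++-identityʳ; ++-assoc; length-++; length-map)
open import Data.List.Membership.Propositional using (_∈_)
open import Data.List.Membership.Propositional.Properties
  using ( ∈-allFin; ∈-lookup; ∈-map⁺; ∈-map⁻; ∈-deduplicate⁺; ∈-deduplicate⁻
        ; ∈-cartesianProduct⁺; ∈-cartesianProductWith⁺; ∈-cartesianProductWith⁻)
open import Data.List.Relation.Unary.All as All using (All; all?)
open import Data.List.Relation.Unary.Any using (here; there; index)
open import Data.List.Relation.Unary.Any.Properties using (lookup-index)
open import Data.List.Relation.Unary.Unique.Propositional using (Unique; _∷_)
open import Data.List.Relation.Unary.Unique.Propositional.Properties using (map⁺)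
import Data.List.Relation.Unary.Unique.DecPropositional.Properties as UniqueDec
open import Data.Nat as ℕ
  using (ℕ; zero; suc; _+_; _*_; _∸_; _≤_; _<_; z≤n; s≤s; _/_; _%_; _≤?_; _≡ᵇ_; NonZero; >-nonZero)
open import Data.Nat.DivMod using (result; _divMod_; m≡m%n+[m/n]*n; m%n<n; [m+kn]%n≡m%n)
open import Data.Nat.Induction using (<-rec)
open import Data.Nat.Properties hiding (_≟_)
open import Data.Nat.Solver using (module +-*-Solver)
open import Data.Product using (∃; _×_; _,_; proj₁; proj₂)
open import Data.Product.Properties using (≡-dec)
open import Data.Sum using (inj₁; inj₂)
open import Function using (id; _∘_; _⇔_; mk⇔; Equivalence)
open import Relation.Binary.Definitions using (DecidableEquality)
open import Relation.Binary.PropositionalEquality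
open import Relation.Nullary using (contradiction)
open import Relation.Nullary.Decidable using (from-yes)

open +-*-Solver using (solve; _:+_; _:*_; _:=_; con)

rot : Letter → Letter
rot O = L
rot L = M
rot M = O

rot-surjective : ∀ y → ∃ λ x → rot x ≡ y
rot-surjective O = M , refl
rot-surjective L = O , refl
rot-surjective M = L , refl

rot^ : ℕ → Letter → Letter
rot^ zero    x = x
rot^ (suc k) x = rot (rot^ k x)

rot^-surjective : ∀ k y → ∃ λ x → rot^ k x ≡ y
rot^-surjective zero    y = y , refl
rot^-surjective (suc k) y with rot-surjective y
... | z , refl with rot^-surjective k z
...   | x , refl = x , refl

σ-rot : ∀ x → σ x ≡ x ∷ rot x ∷ rot (rot x) ∷ []
σ-rot O = refl
σ-rot L = refl
σ-rot M = refl

prefix : ℕ → List Letter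
prefix k = σ^ k (O ∷ [])

prefix-extends : ∀ k → ∃ λ u → prefix (suc k) ≡ prefix k ++ u
prefix-extends zero    = L ∷ M ∷ [] , refl
prefix-extends (suc k) with prefix-extends k
... | u , e = σ* u , trans (cong σ* e) (concatMap-++ σ (prefix k) u)

prefix-mono : ∀ j k → ∃ λ u → prefix (j + k) ≡ prefix k ++ u
prefix-mono zero    k = [] , sym (++-identityʳ (prefix k))
prefix-mono (suc j) k with prefix-mono j k | prefix-extends (j + k)
... | u , e | v , e′ = u ++ v , trans e′ (trans (cong (_++ v) e) (++-assoc (prefix k) u v))

length-σ* : ∀ w → length (σ* w) ≡ length w * 3
length-σ* []      = refl
length-σ* (x ∷ w) = trans (length-++ (σ x)) (cong₂ _+_ (cong length (σ-rot x)) (length-σ* w))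

n<length-prefix : ∀ n → n < length (prefix n)
n<length-prefix zero    = s≤s z≤n
n<length-prefix (suc n) = begin-strict
  suc n                   <⟨ s≤s (s≤s (≤-trans (m≤m*n n 3) (n≤1+n (n * 3)))) ⟩
  suc n * 3               ≤⟨ *-monoˡ-≤ 3 (n<length-prefix n) ⟩
  length (prefix n) * 3   ≡⟨ length-σ* (prefix n) ⟨
  length (prefix (suc n)) ∎
  where open ≤-Reasoning

nth-++ˡ : ∀ u v {n} → n < length u → nth (u ++ v) n ≡ nth u n
nth-++ˡ (x ∷ u) v {zero}  _         = refl
nth-++ˡ (x ∷ u) v {suc n} (s≤s n<) = nth-++ˡ u v n<

nth-prefix-stable : ∀ j k {n} → n < length (prefix k) → nth (prefix (j + k)) n ≡ nth (prefix k) n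
nth-prefix-stable j k {n} n< with prefix-mono j k
... | u , e = trans (cong (λ w → nth w n) e) (nth-++ˡ (prefix k) u n<)

t-prefix : ∀ k {n} → n < length (prefix k) → t n ≡ nth (prefix k) n
t-prefix k {n} n< = begin
  nth (prefix (suc n)) n     ≡⟨ nth-prefix-stable k (suc n) (<-trans (n<1+n n) (n<length-prefix (suc n))) ⟨
  nth (prefix (k + suc n)) n ≡⟨ cong (λ j → nth (prefix j) n) (+-comm k (suc n)) ⟩
  nth (prefix (suc n + k)) n ≡⟨ nth-prefix-stable (suc n) k n< ⟩
  nth (prefix k) n           ∎
  where open ≡-Reasoning

nth-σ* : ∀ w {i} (k : Fin 3) → i < length w → nth (σ* w) (i * 3 + toℕ k) ≡ rot^ (toℕ k) (nth w i)
nth-σ* (x ∷ w) {zero}  zero             _         rewrite σ-rot x = refl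
nth-σ* (x ∷ w) {zero}  (suc zero)       _         rewrite σ-rot x = refl
nth-σ* (x ∷ w) {zero}  (suc (suc zero)) _         rewrite σ-rot x = refl
nth-σ* (x ∷ w) {suc i} k                (s≤s i<) rewrite σ-rot x = nth-σ* w k i<

digit-position< : ∀ i (k : Fin 3) → i * 3 + toℕ k < length (prefix (suc i))
digit-position< i k = begin-strict
  i * 3 + toℕ k           <⟨ +-monoʳ-< (i * 3) (toℕ<n k) ⟩
  i * 3 + 3               ≡⟨ +-comm (i * 3) 3 ⟩
  suc i * 3               ≤⟨ *-monoˡ-≤ 3 (n<length-prefix i) ⟩
  length (prefix i) * 3   ≡⟨ length-σ* (prefix i) ⟨
  length (prefix (suc i)) ∎
  where open ≤-Reasoning

t-digit : ∀ i (k : Fin 3) → t (toℕ k + i * 3) ≡ rot^ (toℕ k) (t i)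
t-digit i k = begin
  t (toℕ k + i * 3)                   ≡⟨ cong t (+-comm (toℕ k) (i * 3)) ⟩
  t (i * 3 + toℕ k)                   ≡⟨ t-prefix (suc i) (digit-position< i k) ⟩
  nth (σ* (prefix i)) (i * 3 + toℕ k) ≡⟨ nth-σ* (prefix i) k (n<length-prefix i) ⟩
  rot^ (toℕ k) (nth (prefix i) i)     ≡⟨ cong (rot^ (toℕ k)) (t-prefix i (n<length-prefix i)) ⟨
  rot^ (toℕ k) (t i)                  ∎
  where open ≡-Reasoning

factor-block : ∀ i → factor (i * 3) 3 ≡ σ (t i)
factor-block i = trans
  (cong₂ _∷_ (t-digit i zero) (cong₂ (λ y z → y ∷ z ∷ []) (t-digit i (suc zero)) (t-digit i (suc (suc zero)))))
  (sym (σ-rot (t i)))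

Occurs : ℕ → Letter → Letter → Set
Occurs d x y = ∃ λ i → t i ≡ x × t (d + i) ≡ y

occurs-1 : ∀ x y → Occurs 1 x y
occurs-1 O O = 44 , refl , refl
occurs-1 O L = 0  , refl , refl
occurs-1 O M = 5  , refl , refl
occurs-1 L O = 14 , refl , refl
occurs-1 L L = 8  , refl , refl
occurs-1 L M = 1  , refl , refl
occurs-1 M O = 4  , refl , refl
occurs-1 M L = 2  , refl , refl
occurs-1 M M = 17 , refl , refl

occurs-2 : ∀ x y → Occurs 2 x y
occurs-2 O O = 5  , refl , refl
occurs-2 O L = 7  , refl , refl
occurs-2 O M = 0  , refl , refl
occurs-2 L O = 3  , refl , refl
occurs-2 L L = 1  , refl , refl
occurs-2 L M = 8  , refl , refl
occurs-2 M O = 17 , refl , refl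
occurs-2 M L = 6  , refl , refl
occurs-2 M M = 2  , refl , refl

occurs-scale : ∀ {d} → (∀ x y → Occurs d x y) → ∀ (k : Fin 3) x y → Occurs (toℕ k + d * 3) x y
occurs-scale {d} occ k x y with rot^-surjective (toℕ k) y
... | z , refl with occ x z
...   | i , refl , refl = i * 3 , t-digit i zero , (begin
  t (toℕ k + d * 3 + i * 3)   ≡⟨ cong t (+-assoc (toℕ k) (d * 3) (i * 3)) ⟩
  t (toℕ k + (d * 3 + i * 3)) ≡⟨ cong (λ j → t (toℕ k + j)) (*-distribʳ-+ 3 d i) ⟨
  t (toℕ k + (d + i) * 3)     ≡⟨ t-digit (d + i) k ⟩
  rot^ (toℕ k) (t (d + i))    ∎)
  where open ≡-Reasoning

occurs : ∀ d x y → Occurs (suc d) x y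
occurs = <-rec (λ d → ∀ x y → Occurs (suc d) x y) step
  where
  step : ∀ d → (∀ {e} → e < d → ∀ x y → Occurs (suc e) x y) → ∀ x y → Occurs (suc d) x y
  step d rec with suc d divMod 3
  ... | result zero    (suc zero)       refl = occurs-1
  ... | result zero    (suc (suc zero)) refl = occurs-2
  ... | result (suc e) k                eq   =
    subst (λ n → ∀ x y → Occurs n x y) (sym eq) (occurs-scale {suc e} (rec e<d) k)
    where
    e<d : e < d
    e<d = ≤-pred (≤-trans (s≤s (s≤s (≤-trans (m≤m*n e 3) (n≤1+n (e * 3)))))
                          (≤-trans (m≤n+m (suc e * 3) (toℕ k)) (≤-reflexive (sym eq))))

factor-++ : ∀ p m n → factor p (m + n) ≡ factor p m ++ factor (m + p) n
factor-++ p zero    n = refl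
factor-++ p (suc m) n = cong (t p ∷_) (trans (factor-++ (suc p) m n)
                                              (cong (λ q → factor (suc p) m ++ factor q n) (+-suc m p)))

length-factor : ∀ p n → length (factor p n) ≡ n
length-factor p zero    = refl
length-factor p (suc n) = cong suc (length-factor (suc p) n)

take-factor : ∀ p {k n} → k ≤ n → take k (factor p n) ≡ factor p k
take-factor p z≤n      = refl
take-factor p (s≤s k≤n) = cong (t p ∷_) (take-factor (suc p) k≤n)

factor-prefix : ∀ i {k} → k ≤ 3 → factor (i * 3) k ≡ take k (σ (t i))
factor-prefix i k≤3 = trans (sym (take-factor (i * 3) k≤3)) (cong (take _) (factor-block i))

count-++ : ∀ a u v → count a (u ++ v) ≡ count a u + count a v
count-++ a []      v = refl
count-++ a (x ∷ u) v = trans (cong ((a ≟L x) +_) (count-++ a u v)) (sym (+-assoc (a ≟L x) _ _))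

count-take : ∀ a k w → count a (take k w) ≤ count a w
count-take a zero    w       = z≤n
count-take a (suc k) []      = z≤n
count-take a (suc k) (x ∷ w) = +-monoʳ-≤ (a ≟L x) (count-take a k w)

count≤length : ∀ a w → count a w ≤ length w
count≤length a []      = z≤n
count≤length a (x ∷ w) = +-mono-≤ (indicator≤1 a x) (count≤length a w)
  where
  indicator≤1 : ∀ a x → a ≟L x ≤ 1
  indicator≤1 O O = s≤s z≤n
  indicator≤1 O L = z≤n
  indicator≤1 O M = z≤n
  indicator≤1 L O = z≤n
  indicator≤1 L L = s≤s z≤n
  indicator≤1 L M = z≤n
  indicator≤1 M O = z≤n
  indicator≤1 M L = z≤n
  indicator≤1 M M = s≤s z≤n

count-σ : ∀ a x → count a (σ x) ≡ 1
count-σ O O = refl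
count-σ O L = refl
count-σ O M = refl
count-σ L O = refl
count-σ L L = refl
count-σ L M = refl
count-σ M O = refl
count-σ M L = refl
count-σ M M = refl

count-factor-++ : ∀ a p m n →
  count a (factor p (m + n)) ≡ count a (factor p m) + count a (factor (m + p) n)
count-factor-++ a p m n = trans (cong (count a) (factor-++ p m n)) (count-++ a (factor p m) _)

count-blocks : ∀ a Q i k → count a (factor (i * 3) (Q * 3 + k)) ≡ Q + count a (factor ((Q + i) * 3) k)
count-blocks a zero    i k = refl
count-blocks a (suc Q) i k = begin
  count a (factor (i * 3) (3 + (Q * 3 + k)))
    ≡⟨ count-factor-++ a (i * 3) 3 (Q * 3 + k) ⟩
  count a (factor (i * 3) 3) + count a (factor (suc i * 3) (Q * 3 + k))
    ≡⟨ cong₂ _+_ (trans (cong (count a) (factor-block i)) (count-σ a (t i))) (count-blocks a Q (suc i) k) ⟩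
  suc (Q + count a (factor ((Q + suc i) * 3) k))
    ≡⟨ cong (λ j → suc (Q + count a (factor (j * 3) k))) (+-suc Q i) ⟩
  suc (Q + count a (factor (suc (Q + i) * 3) k))
    ∎
  where open ≡-Reasoning

length-counts : ∀ w → count O w + (count L w + count M w) ≡ length w
length-counts []      = refl
length-counts (O ∷ w) = cong suc (length-counts w)
length-counts (L ∷ w) = trans (+-suc (count O w) _) (cong suc (length-counts w))
length-counts (M ∷ w) =
  trans (cong (count O w +_) (+-suc (count L w) _)) (trans (+-suc (count O w) _) (cong suc (length-counts w)))

letters : List Letter
letters = O ∷ L ∷ M ∷ []

∈-letters : ∀ x → x ∈ letters
∈-letters O = here refl
∈-letters L = there (here refl)
∈-letters M = there (there (here refl))

words : ℕ → List (List Letter)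
words zero    = [] ∷ []
words (suc n) = cartesianProductWith _∷_ letters (words n)

factor∈words : ∀ n p → factor p n ∈ words n
factor∈words zero    p = here refl
factor∈words (suc n) p = ∈-cartesianProductWith⁺ _∷_ (∈-letters (t p)) (factor∈words n (suc p))

length-words : ∀ n {w} → w ∈ words n → length w ≡ n
length-words zero    (here refl) = refl
length-words (suc n) w∈ with ∈-cartesianProductWith⁻ _∷_ letters (words n) w∈
... | x , w′ , _ , w′∈ , refl = cong suc (length-words n w′∈)

short-word-occurs : ∀ w → length w ≤ 2 → ∃ λ p → factor p (length w) ≡ w
short-word-occurs []          _ = 0 , refl
short-word-occurs (x ∷ [])    _ with occurs 0 x x
... | i , refl , _ = i , refl
short-word-occurs (x ∷ y ∷ []) _ with occurs 0 x y
... | i , refl , refl = i , refl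
short-word-occurs (_ ∷ _ ∷ _ ∷ _) (s≤s (s≤s ()))

V : Set
V = ℕ × ℕ × ℕ

parikh : List Letter → V
parikh w = count O w , count L w , count M w

shift : ℕ → V → V
shift N (a , b , c) = N + a , N + b , N + c

data Length : ℕ → Set where
  short : ∀ (n : Fin 3) → Length (toℕ n)
  long  : ∀ N (r : Fin 3) → Length (toℕ r + suc N * 3)

length-view : ∀ n → Length n
length-view n with n divMod 3
... | result zero    r refl = subst Length (sym (+-identityʳ (toℕ r))) (short r)
... | result (suc N) r refl = long N r

-- A configuration (s , x , y) describes a factor of length r + 3(N+1) starting at s + 3i with
-- x = t i: the factor is σ x without its first s letters, then N + carry s r full blocks, then the
-- first residue s r letters of σ y.
Config : Set
Config = Fin 3 × Letter × Letter

configs : List Config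
configs = cartesianProduct (allFin 3) (cartesianProduct letters letters)

∈-configs : ∀ c → c ∈ configs
∈-configs (s , x , y) = ∈-cartesianProduct⁺ (∈-allFin s) (∈-cartesianProduct⁺ (∈-letters x) (∈-letters y))

carry residue : Fin 3 → Fin 3 → ℕ
carry   s r = (toℕ s + toℕ r) / 3
residue s r = (toℕ s + toℕ r) % 3

excess : Fin 3 → Config → Letter → ℕ
excess r (s , x , y) a = suc (carry s r) + count a (take (residue s r) (σ y)) ∸ count a (take (toℕ s) (σ x))

offset : Fin 3 → Config → V
offset r c = excess r c O , excess r c L , excess r c M

window-length : ∀ N r s → toℕ s + (toℕ r + suc N * 3) ≡ suc (carry s r + N) * 3 + residue s r
window-length N r s = begin
  toℕ s + (toℕ r + suc N * 3)                   ≡⟨ +-assoc (toℕ s) (toℕ r) (suc N * 3) ⟨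
  toℕ s + toℕ r + suc N * 3                     ≡⟨ cong (_+ suc N * 3) (m≡m%n+[m/n]*n (toℕ s + toℕ r) 3) ⟩
  residue s r + carry s r * 3 + suc N * 3       ≡⟨ solve 3 (λ b c N → b :+ c :* con 3 :+ (con 1 :+ N) :* con 3
                                                                  := (con 1 :+ (c :+ N)) :* con 3 :+ b)
                                                          refl (residue s r) (carry s r) N ⟩
  suc (carry s r + N) * 3 + residue s r         ∎
  where open ≡-Reasoning

count-long : ∀ N r s i a →
  count a (factor (toℕ s + i * 3) (toℕ r + suc N * 3)) ≡ N + excess r (s , t i , t (suc (carry s r + N) + i)) a
count-long N r s i a = begin
  P                   ≡⟨ m+n∸m≡n A P ⟨
  A + P ∸ A           ≡⟨ cong (_∸ A) window ⟩
  N + (suc c + B) ∸ A ≡⟨ +-∸-assoc N A≤ ⟩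
  N + (suc c + B ∸ A) ∎
  where
  open ≡-Reasoning
  c = carry s r
  Q = suc (c + N)
  A = count a (take (toℕ s) (σ (t i)))
  B = count a (take (residue s r) (σ (t (Q + i))))
  P = count a (factor (toℕ s + i * 3) (toℕ r + suc N * 3))
  A≤ : A ≤ suc c + B
  A≤ = ≤-trans (≤-trans (count-take a (toℕ s) (σ (t i))) (≤-reflexive (count-σ a (t i)))) (s≤s z≤n)
  window : A + P ≡ N + (suc c + B)
  window = begin
    A + P
      ≡⟨ cong (λ w → count a w + P) (factor-prefix i (<⇒≤ (toℕ<n s))) ⟨
    count a (factor (i * 3) (toℕ s)) + P
      ≡⟨ count-factor-++ a (i * 3) (toℕ s) _ ⟨
    count a (factor (i * 3) (toℕ s + (toℕ r + suc N * 3)))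
      ≡⟨ cong (λ n → count a (factor (i * 3) n)) (window-length N r s) ⟩
    count a (factor (i * 3) (Q * 3 + residue s r))
      ≡⟨ count-blocks a Q i (residue s r) ⟩
    Q + count a (factor ((Q + i) * 3) (residue s r))
      ≡⟨ cong (λ w → Q + count a w) (factor-prefix (Q + i) (<⇒≤ (m%n<n (toℕ s + toℕ r) 3))) ⟩
    Q + B
      ≡⟨ solve 3 (λ c N B → (con 1 :+ (c :+ N)) :+ B := N :+ ((con 1 :+ c) :+ B)) refl c N B ⟩
    N + (suc c + B)
      ∎

long-config : ∀ N r p → ∃ λ c → ∀ a → count a (factor p (toℕ r + suc N * 3)) ≡ N + excess r c a
long-config N r p with p divMod 3
... | result i s refl = (s , t i , t (suc (carry s r + N) + i)) , count-long N r s i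

config-occurs : ∀ N r c → ∃ λ p → ∀ a → count a (factor p (toℕ r + suc N * 3)) ≡ N + excess r c a
config-occurs N r (s , x , y) with occurs (carry s r + N) x y
... | i , refl , refl = toℕ s + i * 3 , count-long N r s i

parikh-shift : ∀ w N r c → (∀ a → count a w ≡ N + excess r c a) → parikh w ≡ shift N (offset r c)
parikh-shift w N r c h = cong₂ _,_ (h O) (cong₂ _,_ (h L) (h M))

excess-balanced : ∀ r a c c′ → excess r c a ≤ 2 + excess r c′ a
excess-balanced r a c c′ =
  All.lookup (All.lookup (All.lookup (All.lookup table (∈-allFin r)) (∈-letters a)) (∈-configs c)) (∈-configs c′)
  where
  table : All (λ r → All (λ a → All (λ c → All (λ c′ → excess r c a ≤ 2 + excess r c′ a)
            configs) configs) letters) (allFin 3)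
  table = from-yes (all? (λ r → all? (λ a → all? (λ c → all? (λ c′ → excess r c a ≤? 2 + excess r c′ a)
            configs) configs) letters) (allFin 3))

factor-balanced : ∀ n p q a → count a (factor p n) ≤ 2 + count a (factor q n)
factor-balanced n p q a with length-view n
... | short k = ≤-trans (count≤length a (factor p (toℕ k)))
                  (≤-trans (≤-reflexive (length-factor p (toℕ k))) (≤-trans (toℕ≤pred[n] k) (m≤m+n 2 _)))
... | long N r with long-config N r p | long-config N r q
...   | c , hp | c′ , hq = begin
  count a (factor p n)     ≡⟨ hp a ⟩
  N + excess r c a         ≤⟨ +-monoʳ-≤ N (excess-balanced r a c c′) ⟩
  N + (2 + excess r c′ a)  ≡⟨ trans (+-suc N _) (cong suc (+-suc N _)) ⟩
  2 + (N + excess r c′ a)  ≡⟨ cong (2 +_) (hq a) ⟨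
  2 + count a (factor q n) ∎
  where open ≤-Reasoning

no-small-solution : ∀ {ℓ m} j k → ℓ < m → m ≢ 2 * ℓ → j ≤ 2 → k ≤ 2 → j * ℓ ≡ k * m → k ≡ 0
no-small-solution         j zero    _   _    _ _ _ = refl
no-small-solution {ℓ} {m} 0 (suc k) ℓ<m _    _ _ e =
  contradiction e (<⇒≢ (<-≤-trans (≤-<-trans z≤n ℓ<m) (m≤m+n m (k * m))))
no-small-solution {ℓ} {m} 1 (suc k) ℓ<m _    _ _ e =
  contradiction e (<⇒≢ (<-≤-trans (subst (_< m) (sym (+-identityʳ ℓ)) ℓ<m) (m≤m+n m (k * m))))
no-small-solution         2 1       _   m≢2ℓ _ _ e = contradiction (sym (trans e (+-identityʳ _))) m≢2ℓ
no-small-solution {ℓ} {m} 2 2       ℓ<m _    _ _ e = contradiction (*-cancelˡ-≡ ℓ m 2 e) (<⇒≢ ℓ<m)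
no-small-solution         2 (suc (suc (suc k))) _ _ _              (s≤s (s≤s ())) _
no-small-solution         (suc (suc (suc j))) _ _ _ (s≤s (s≤s ())) _              _

linear-cancel-≤ : ∀ {ℓ m a b c d} → 1 ≤ ℓ → ℓ < m → m ≢ 2 * ℓ → a ≤ 2 + c → b ≤ d → d ≤ 2 + b →
                  ℓ * a + m * b ≡ ℓ * c + m * d → a ≡ c × b ≡ d
linear-cancel-≤ {ℓ} {m} {a} {b} {c} {d} 1≤ℓ ℓ<m m≢2ℓ a≤2+c b≤d d≤2+b eq = a≡c , b≡d
  where
  instance
    ℓ≢0 : NonZero ℓ
    ℓ≢0 = >-nonZero 1≤ℓ
  k = d ∸ b
  ℓa≡ℓc+mk : ℓ * a ≡ ℓ * c + m * k
  ℓa≡ℓc+mk = +-cancelʳ-≡ (m * b) (ℓ * a) (ℓ * c + m * k) (begin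
    ℓ * a + m * b           ≡⟨ eq ⟩
    ℓ * c + m * d           ≡⟨ cong (λ x → ℓ * c + m * x) (m+[n∸m]≡n b≤d) ⟨
    ℓ * c + m * (b + k)     ≡⟨ solve 5 (λ ℓ m b c k → ℓ :* c :+ m :* (b :+ k) := ℓ :* c :+ m :* k :+ m :* b)
                                       refl ℓ m b c k ⟩
    ℓ * c + m * k + m * b   ∎)
    where open ≡-Reasoning
  c≤a : c ≤ a
  c≤a = *-cancelˡ-≤ ℓ (≤-trans (m≤m+n (ℓ * c) (m * k)) (≤-reflexive (sym ℓa≡ℓc+mk)))
  j = a ∸ c
  jℓ≡km : j * ℓ ≡ k * m
  jℓ≡km = begin
    j * ℓ   ≡⟨ *-comm j ℓ ⟩
    ℓ * j   ≡⟨ +-cancelˡ-≡ (ℓ * c) (ℓ * j) (m * k) (begin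
                 ℓ * c + ℓ * j ≡⟨ *-distribˡ-+ ℓ c j ⟨
                 ℓ * (c + j)   ≡⟨ cong (ℓ *_) (m+[n∸m]≡n c≤a) ⟩
                 ℓ * a         ≡⟨ ℓa≡ℓc+mk ⟩
                 ℓ * c + m * k ∎) ⟩
    m * k   ≡⟨ *-comm m k ⟩
    k * m   ∎
    where open ≡-Reasoning
  k≡0 : k ≡ 0
  k≡0 = no-small-solution j k ℓ<m m≢2ℓ (difference≤2 a≤2+c) (difference≤2 d≤2+b) jℓ≡km
    where
    difference≤2 : ∀ {x y} → x ≤ 2 + y → x ∸ y ≤ 2
    difference≤2 {x} {y} x≤ = m≤n+o⇒m∸n≤o x y (≤-trans x≤ (≤-reflexive (+-comm 2 y)))
  j≡0 : j ≡ 0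
  j≡0 = *-cancelʳ-≡ j 0 ℓ (trans jℓ≡km (cong (_* m) k≡0))
  a≡c : a ≡ c
  a≡c = trans (sym (m+[n∸m]≡n c≤a)) (trans (cong (c +_) j≡0) (+-identityʳ c))
  b≡d : b ≡ d
  b≡d = trans (sym (+-identityʳ b)) (trans (cong (b +_) (sym k≡0)) (m+[n∸m]≡n b≤d))

linear-cancel : ∀ {ℓ m a b c d} → 1 ≤ ℓ → ℓ < m → m ≢ 2 * ℓ →
                a ≤ 2 + c → c ≤ 2 + a → b ≤ 2 + d → d ≤ 2 + b →
                ℓ * a + m * b ≡ ℓ * c + m * d → a ≡ c × b ≡ d
linear-cancel {b = b} {d = d} 1≤ℓ ℓ<m m≢2ℓ a≤ c≤ b≤ d≤ eq with ≤-total b d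
... | inj₁ b≤d = linear-cancel-≤ 1≤ℓ ℓ<m m≢2ℓ a≤ b≤d d≤ eq
... | inj₂ d≤b with linear-cancel-≤ 1≤ℓ ℓ<m m≢2ℓ c≤ d≤b b≤ (sym eq)
...   | c≡a , d≡b = sym c≡a , sym d≡b

lookup-injective : ∀ {A : Set} {xs : List A} → Unique xs → ∀ i j → lookup xs i ≡ lookup xs j → i ≡ j
lookup-injective (_    ∷ _)   zero    zero    _ = refl
lookup-injective (x∉xs ∷ _)   zero    (suc j) e = ⊥-elim (All.lookup x∉xs (∈-lookup j) e)
lookup-injective (x∉xs ∷ _)   (suc i) zero    e = ⊥-elim (All.lookup x∉xs (∈-lookup i) (sym e))
lookup-injective (_    ∷ xs!) (suc i) (suc j) e = cong suc (lookup-injective xs! i j e)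

numClasses-byKey : ∀ {K : Set} (R : List Letter → List Letter → Set) n (κ : ℕ → K) (ks : List K) →
  (∀ p q → R (factor p n) (factor q n) → κ p ≡ κ q) →
  (∀ p q → κ p ≡ κ q → R (factor p n) (factor q n)) →
  Unique ks → (∀ p → κ p ∈ ks) → (∀ {k} → k ∈ ks → ∃ λ p → κ p ≡ k) →
  NumClasses R n (length ks)
numClasses-byKey R n κ ks R⇒≡ ≡⇒R ks! κ∈ks realised = pos , distinct , cover
  where
  pos : Fin (length ks) → ℕ
  pos j = proj₁ (realised (∈-lookup j))
  κ-pos : ∀ j → κ (pos j) ≡ lookup ks j
  κ-pos j = proj₂ (realised (∈-lookup j))
  distinct : ∀ i j → R (factor (pos i) n) (factor (pos j) n) → i ≡ j
  distinct i j r = lookup-injective ks! i j (trans (sym (κ-pos i)) (trans (R⇒≡ _ _ r) (κ-pos j)))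
  cover : ∀ p → ∃ λ j → R (factor p n) (factor (pos j) n)
  cover p = index (κ∈ks p) , ≡⇒R p _ (trans (lookup-index (κ∈ks p)) (sym (κ-pos _)))

numClasses-transfer : ∀ {R S : List Letter → List Letter → Set} {n k} →
  (∀ p q → R (factor p n) (factor q n) → S (factor p n) (factor q n)) →
  (∀ p q → S (factor p n) (factor q n) → R (factor p n) (factor q n)) →
  NumClasses R n k → NumClasses S n k
numClasses-transfer R⇒S S⇒R (pos , distinct , cover) =
  pos , (λ i j s → distinct i j (S⇒R _ _ s)) , λ p → proj₁ (cover p) , R⇒S _ _ (proj₂ (cover p))

-- Long factors have Parikh vectors shift N (offset r c), so an invariant compatible with shift N
-- separates them exactly as it separates the finitely many offsets.
record ParikhInvariant (R : List Letter → List Letter → Set) : Set₁ where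
  field
    Key                : Set
    _≟_                : DecidableEquality Key
    key                : V → Key
    shiftKey           : ℕ → Key → Key
    key-shift          : ∀ N v → key (shift N v) ≡ shiftKey N (key v)
    shiftKey-injective : ∀ N {k k′} → shiftKey N k ≡ shiftKey N k′ → k ≡ k′
    characterises      : ∀ {u v} → length u ≡ length v → R u v ⇔ (key (parikh u) ≡ key (parikh v))

module _ {R : List Letter → List Letter → Set} (I : ParikhInvariant R) where
  open ParikhInvariant I

  shortKeys : ℕ → List Key
  shortKeys n = deduplicate _≟_ (map (key ∘ parikh) (words n))

  longKeys : Fin 3 → List Key
  longKeys r = deduplicate _≟_ (map (key ∘ offset r) configs)

  private
    κ : ℕ → ℕ → Key
    κ n p = key (parikh (factor p n))

    R⇒≡ : ∀ n p q → R (factor p n) (factor q n) → κ n p ≡ κ n q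
    R⇒≡ n p q = Equivalence.to (characterises (trans (length-factor p n) (sym (length-factor q n))))

    ≡⇒R : ∀ n p q → κ n p ≡ κ n q → R (factor p n) (factor q n)
    ≡⇒R n p q = Equivalence.from (characterises (trans (length-factor p n) (sym (length-factor q n))))

  numClasses-short : ∀ (n : Fin 3) → NumClasses R (toℕ n) (length (shortKeys (toℕ n)))
  numClasses-short n = numClasses-byKey R (toℕ n) (κ (toℕ n)) (shortKeys (toℕ n))
    (R⇒≡ (toℕ n)) (≡⇒R (toℕ n)) (UniqueDec.deduplicate-! _≟_ _) member realised
    where
    member : ∀ p → κ (toℕ n) p ∈ shortKeys (toℕ n)
    member p = ∈-deduplicate⁺ _≟_ (∈-map⁺ (key ∘ parikh) (factor∈words (toℕ n) p))
    realised : ∀ {k} → k ∈ shortKeys (toℕ n) → ∃ λ p → κ (toℕ n) p ≡ k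
    realised k∈ with ∈-map⁻ (key ∘ parikh) (∈-deduplicate⁻ _≟_ (map (key ∘ parikh) (words (toℕ n))) k∈)
    ... | w , w∈ , refl with length-words (toℕ n) w∈
    ...   | |w|≡n with short-word-occurs w (≤-trans (≤-reflexive |w|≡n) (toℕ≤pred[n] n))
    ...     | p , e = p , cong (key ∘ parikh) (subst (λ m → factor p m ≡ w) |w|≡n e)

  numClasses-long : ∀ N r → NumClasses R (toℕ r + suc N * 3) (length (longKeys r))
  numClasses-long N r = subst (NumClasses R n) (length-map (shiftKey N) (longKeys r))
    (numClasses-byKey R n (κ n) (map (shiftKey N) (longKeys r)) (R⇒≡ n) (≡⇒R n)
      (map⁺ (shiftKey-injective N) (UniqueDec.deduplicate-! _≟_ (map (key ∘ offset r) configs)))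
      member realised)
    where
    n = toℕ r + suc N * 3
    κ-config : ∀ p c → (∀ a → count a (factor p n) ≡ N + excess r c a) → κ n p ≡ shiftKey N (key (offset r c))
    κ-config p c h = trans (cong key (parikh-shift (factor p n) N r c h)) (key-shift N (offset r c))
    member : ∀ p → κ n p ∈ map (shiftKey N) (longKeys r)
    member p with long-config N r p
    ... | c , h = subst (_∈ map (shiftKey N) (longKeys r)) (sym (κ-config p c h))
                    (∈-map⁺ (shiftKey N) (∈-deduplicate⁺ _≟_ (∈-map⁺ (key ∘ offset r) (∈-configs c))))
    realised : ∀ {k} → k ∈ map (shiftKey N) (longKeys r) → ∃ λ p → κ n p ≡ k
    realised k∈ with ∈-map⁻ (shiftKey N) k∈
    ... | _ , k∈keys , refl
          with ∈-map⁻ (key ∘ offset r) {xs = configs} (∈-deduplicate⁻ _≟_ (map (key ∘ offset r) configs) k∈keys)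
    ...   | c , _ , refl with config-occurs N r c
    ...     | p , h = p , κ-config p c h

abEq⇔parikh : ∀ {u v} → AbEq u v ⇔ (parikh u ≡ parikh v)
abEq⇔parikh = mk⇔ (λ h → cong₂ _,_ (h O) (cong₂ _,_ (h L) (h M)))
                  (λ { e O → cong proj₁ e ; e L → cong (proj₁ ∘ proj₂) e ; e M → cong (proj₂ ∘ proj₂) e })

shift-injective : ∀ N {u v} → shift N u ≡ shift N v → u ≡ v
shift-injective N {_ , _ , _} {_ , _ , _} e = cong₂ _,_ (+-cancelˡ-≡ N _ _ (cong proj₁ e))
  (cong₂ _,_ (+-cancelˡ-≡ N _ _ (cong (proj₁ ∘ proj₂) e)) (+-cancelˡ-≡ N _ _ (cong (proj₂ ∘ proj₂) e)))

abelian : ParikhInvariant AbEq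
abelian = record
  { Key                = V
  ; _≟_                = ≡-dec ℕ._≟_ (≡-dec ℕ._≟_ ℕ._≟_)
  ; key                = id
  ; shiftKey           = shift
  ; key-shift          = λ _ _ → refl
  ; shiftKey-injective = shift-injective
  ; characterises      = λ {u} {v} _ → abEq⇔parikh {u} {v}
  }

weight : V → ℕ
weight (_ , b , c) = b + 2 * c

weight-shift : ∀ N v → weight (shift N v) ≡ N * 3 + weight v
weight-shift N (_ , b , c) =
  solve 3 (λ N b c → (N :+ b) :+ con 2 :* (N :+ c) := N :* con 3 :+ (b :+ con 2 :* c)) refl N b c

addEq-weight : ∀ ℓ w → ℓ * count L w + 2 * ℓ * count M w ≡ ℓ * weight (parikh w)
addEq-weight ℓ w =
  solve 3 (λ ℓ b c → ℓ :* b :+ con 2 :* ℓ :* c := ℓ :* (b :+ con 2 :* c)) refl ℓ (count L w) (count M w)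

doubled : ∀ {ℓ} → 1 ≤ ℓ → ParikhInvariant (AddEq ℓ (2 * ℓ))
doubled {ℓ} 1≤ℓ = record
  { Key                = ℕ
  ; _≟_                = ℕ._≟_
  ; key                = weight
  ; shiftKey           = λ N w → N * 3 + w
  ; key-shift          = weight-shift
  ; shiftKey-injective = λ N → +-cancelˡ-≡ (N * 3) _ _
  ; characterises      = λ {u} {v} |u|≡|v| → mk⇔
      (λ (_ , e) → *-cancelˡ-≡ _ _ ℓ {{>-nonZero 1≤ℓ}}
                     (trans (sym (addEq-weight ℓ u)) (trans e (addEq-weight ℓ v))))
      (λ e → |u|≡|v| , trans (addEq-weight ℓ u) (trans (cong (ℓ *_) e) (sym (addEq-weight ℓ v))))
  }

abEq⇒addEq : ∀ ℓ m {u v} → AbEq u v → AddEq ℓ m u v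
abEq⇒addEq ℓ m {u} {v} h =
  trans (sym (length-counts u)) (trans (cong₂ _+_ (h O) (cong₂ _+_ (h L) (h M))) (length-counts v)) ,
  cong₂ (λ b c → ℓ * b + m * c) (h L) (h M)

addEq⇒abEq : ∀ {ℓ m u v} → 1 ≤ ℓ → ℓ < m → m ≢ 2 * ℓ →
  (∀ a → count a u ≤ 2 + count a v) → (∀ a → count a v ≤ 2 + count a u) → AddEq ℓ m u v → AbEq u v
addEq⇒abEq {u = u} {v} 1≤ℓ ℓ<m m≢2ℓ u≤v v≤u (|u|≡|v| , e) = λ where
    O → +-cancelʳ-≡ (count L v + count M v) (count O u) (count O v) (begin
          count O u + (count L v + count M v) ≡⟨ cong (λ x → count O u + x) (cong₂ _+_ L≡ M≡) ⟨
          count O u + (count L u + count M u) ≡⟨ length-counts u ⟩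
          length u                            ≡⟨ |u|≡|v| ⟩
          length v                            ≡⟨ length-counts v ⟨
          count O v + (count L v + count M v) ∎)
    L → L≡
    M → M≡
  where
  open ≡-Reasoning
  LM = linear-cancel 1≤ℓ ℓ<m m≢2ℓ (u≤v L) (v≤u L) (u≤v M) (v≤u M) e
  L≡ = proj₁ LM
  M≡ = proj₂ LM

abValue-short : ∀ (n : Fin 3) → length (shortKeys abelian (toℕ n)) ≡ abValue (toℕ n)
abValue-short zero             = refl
abValue-short (suc zero)       = refl
abValue-short (suc (suc zero)) = refl

abValue-long : ∀ N r → length (longKeys abelian r) ≡ abValue (toℕ r + suc N * 3)
abValue-long N zero             = cong (λ x → if x ≡ᵇ 0 then 7 else 6) (sym ([m+kn]%n≡m%n 0 (suc N) 3))
abValue-long N (suc zero)       = cong (λ x → if x ≡ᵇ 0 then 7 else 6) (sym ([m+kn]%n≡m%n 1 (suc N) 3))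
abValue-long N (suc (suc zero)) = cong (λ x → if x ≡ᵇ 0 then 7 else 6) (sym ([m+kn]%n≡m%n 2 (suc N) 3))

addValue2-short : ∀ {ℓ} (1≤ℓ : 1 ≤ ℓ) (n : Fin 3) →
                  length (shortKeys (doubled 1≤ℓ) (toℕ n)) ≡ addValue2 (toℕ n)
addValue2-short _ zero             = refl
addValue2-short _ (suc zero)       = refl
addValue2-short _ (suc (suc zero)) = refl

addValue2-long : ∀ {ℓ} (1≤ℓ : 1 ≤ ℓ) N r →
                 length (longKeys (doubled 1≤ℓ) r) ≡ addValue2 (toℕ r + suc N * 3)
addValue2-long _ N zero             = refl
addValue2-long _ N (suc zero)       = refl
addValue2-long _ N (suc (suc zero)) = refl

abelian-complexity : ∀ n → NumClasses AbEq n (abValue n)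
abelian-complexity n with length-view n
... | short k  = subst (NumClasses AbEq (toℕ k)) (abValue-short k) (numClasses-short abelian k)
... | long N r = subst (NumClasses AbEq (toℕ r + suc N * 3)) (abValue-long N r) (numClasses-long abelian N r)

additive-complexity : ∀ {ℓ m} → 1 ≤ ℓ → ℓ < m → m ≢ 2 * ℓ → ∀ n → NumClasses (AddEq ℓ m) n (abValue n)
additive-complexity {ℓ} {m} 1≤ℓ ℓ<m m≢2ℓ n = numClasses-transfer {AbEq} {AddEq ℓ m} {n}
  (λ p q → abEq⇒addEq ℓ m {factor p n} {factor q n})
  (λ p q → addEq⇒abEq {u = factor p n} {factor q n} 1≤ℓ ℓ<m m≢2ℓ
             (factor-balanced n p q) (factor-balanced n q p))
  (abelian-complexity n)

additive-complexity-doubled : ∀ {ℓ} → 1 ≤ ℓ → ∀ n → NumClasses (AddEq ℓ (2 * ℓ)) n (addValue2 n)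
additive-complexity-doubled {ℓ} 1≤ℓ n with length-view n
... | short k  = subst (NumClasses (AddEq ℓ (2 * ℓ)) (toℕ k)) (addValue2-short 1≤ℓ k)
                       (numClasses-short (doubled 1≤ℓ) k)
... | long N r = subst (NumClasses (AddEq ℓ (2 * ℓ)) (toℕ r + suc N * 3)) (addValue2-long 1≤ℓ N r)
                       (numClasses-long (doubled 1≤ℓ) N r)

theorem4p5 : (ℓ m : ℕ) → 1 ≤ ℓ → ℓ < m →
    ((n : ℕ) → NumClasses AbEq n (abValue n))
    × (m ≢ 2 * ℓ → (n : ℕ) → NumClasses (AddEq ℓ m) n (abValue n))
    × (m ≡ 2 * ℓ → (n : ℕ) → NumClasses (AddEq ℓ m) n (addValue2 n))
theorem4p5 ℓ m 1≤ℓ ℓ<m =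
  abelian-complexity , additive-complexity 1≤ℓ ℓ<m , λ { refl → additive-complexity-doubled 1≤ℓ }
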